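{- Let $a_0=0$ and let $(a_n)_{n\ge 1}$ be the increasing sequence of positive integers whose odd part is of the form $4k+1$; let $d_n=a_{n+1}-a_n$ and $\mathbf{d}'=(d_{n+1})_{n\ge 0}$. Define the morphism $f$ on $\{0,1,2,3\}^*$ by $f(0)=01$, $f(1)=21$, $f(2)=03$, $f(3)=23$, and the morphism $g:\{0,1,2,3\}^*\to\{1,2,3,4\}^*$ by $g(0)=121$, $g(1)=31$, $g(2)=13$, $g(3)=4$. Then $\mathbf{d}'=g(f^{\infty}(0))=\lim_{n\to\infty}g(f^{n}(0))$. In particular, $(d_n)_{n\ge 0}$ is morphic.
   Context: The odd part of a positive integer $m$ is $m/2^v$ with $2^v$ the largest power of $2$ dividing $m$. $f^{\infty}(0)$ denotes the infinite fixed point of $f$ beginning with $0$, i.e. the limit of the words $f^n(0)$ (each a prefix of the next). A sequence is morphic if it is the image under a coding (letter-to-letter map) of a fixed point of a morphism. -}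

module Defs where

open import Data.Nat using (ℕ; zero; suc; _+_; _*_; _∸_; _^_; _<_; _%_)
open import Data.Nat.Properties
open import Data.Fin using (Fin; fromℕ<)
open import Data.List using (List; []; _∷_; [_]; length; lookup; concatMap)
open import Data.Product using (Σ; ∃; ∃-syntax; _×_; _,_)
open import Function.Bundles using (_⇔_)
open import Relation.Binary.PropositionalEquality using (_≡_)

IsOddPart : ℕ → ℕ → Set
IsOddPart m o = ∃[ v ] (m ≡ 2 ^ v * o × o % 2 ≡ 1)

Good : ℕ → Set
Good m = 0 < m × ∃[ o ] (IsOddPart m o × ∃[ k ] (o ≡ 4 * k + 1))

IsGoodSeq : (ℕ → ℕ) → Set
IsGoodSeq a =
  a 0 ≡ 0 ×
  (∀ n → a n < a (suc n)) ×
  (∀ m → Good m ⇔ (∃[ n ] (a (suc n) ≡ m)))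

diffs : (ℕ → ℕ) → ℕ → ℕ
diffs a n = a (suc n) ∸ a n

data L4 : Set where
  l0 l1 l2 l3 : L4

f : L4 → List L4
f l0 = l0 ∷ l1 ∷ []
f l1 = l2 ∷ l1 ∷ []
f l2 = l0 ∷ l3 ∷ []
f l3 = l2 ∷ l3 ∷ []

g : L4 → List ℕ
g l0 = 1 ∷ 2 ∷ 1 ∷ []
g l1 = 3 ∷ 1 ∷ []
g l2 = 1 ∷ 3 ∷ []
g l3 = 4 ∷ []

ext : {A B : Set} → (A → List B) → List A → List B
ext σ w = concatMap σ w

iter : {A : Set} → (A → List A) → ℕ → List A → List A
iter σ zero w = w
iter σ (suc n) w = ext σ (iter σ n w)

IsLimitOf : {A : Set} → (ℕ → A) → (ℕ → List A) → Set
IsLimitOf s w =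
  (∀ n i (p : i < length (w n)) → s i ≡ lookup (w n) (fromℕ< p)) ×
  (∀ N → ∃[ n ] (N < length (w n)))

-- s is morphic: s = τ(x) where x = σ^∞(b) is a fixed point of a morphism σ
-- on a finite alphabet Fin k beginning with the letter b (σ(b) begins with b),
-- x being the limit of σ^n(b), and τ a coding (letter-to-letter map)
IsMorphic : (ℕ → ℕ) → Set
IsMorphic s =
  ∃[ k ] Σ (Fin k → List (Fin k)) λ σ → Σ (Fin k) λ b →
    Σ (List (Fin k)) λ rest → (σ b ≡ b ∷ rest) ×
    Σ (ℕ → Fin k) λ x → Σ (Fin k → ℕ) λ τ →
      IsLimitOf x (λ n → iter σ n [ b ]) ×
      (∀ i → s i ≡ τ (x i))

-- Let x_s ∈ {0,1,2,3} record which of 4s+2 and 4s+4 are good (4s+1 and 4s+5 always are,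
-- 4s+3 never is), so that g(x_s) lists the gaps between consecutive good numbers from 4s+1
-- to 4s+5. Since m and 2m are good together, f(x_s) = x_{2s} x_{2s+1}; hence
-- f^n(0) = x_0 ⋯ x_{2^n-1}, and 1 followed by g(f^n(0)) is a prefix of (d_n). For morphicity,
-- the non-uniform g is absorbed into a morphism σ on eight letters: a marked first letter of
-- each g-block, erasable letters for the rest of a block, and a start letter for d_0 = 1.
module Submission where

open import Defs
open import Data.Bool.Base using (Bool; true; false)
open import Data.Empty using (⊥-elim)
open import Data.Fin.Base using (Fin; fromℕ<)
import Data.Fin.Base as Fin
open import Data.List.Base using (List; []; _∷_; [_]; _++_; _∷ʳ_; length; lookup; map; concatMap; applyUpTo)
open import Data.List.Properties using (∷-injectiveˡ; ∷-injectiveʳ; ++-assoc; ++-identityʳ; length-++; length-map; length-applyUpTo; applyUpTo-∷ʳ; map-applyUpTo; concatMap-++; map-concatMap; concatMap-cong)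
open import Data.Nat.Base using (ℕ; zero; suc; _+_; _*_; _∸_; _^_; _≤_; _<_; _%_; z≤n; s≤s; z<s; s≤s⁻¹)
open import Data.Nat.Properties
open import Data.Nat.ListAction using (sum)
open import Data.Nat.DivMod using (m*n%n≡0; %-remove-+ˡ; %-remove-+ʳ)
open import Data.Nat.Divisibility using (_∣_; divides; ∣-trans; m∣m*n)
open import Data.Nat.Induction using (<-rec)
open import Data.Nat.Tactic.RingSolver using (solve-∀)
open import Data.Product.Base using (Σ; ∃-syntax; _×_; _,_; proj₁; proj₂; map₂)
open import Data.Sum.Base using (inj₁; inj₂)
open import Data.Unit.Base using (⊤; tt)
open import Function.Base using (_∘_)
open import Function.Bundles using (_⇔_; mk⇔; Equivalence)
open import Function.Properties.Equivalence using () renaming (sym to ⇔-sym)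
open import Relation.Binary.Definitions using (tri<; tri≈; tri>)
open import Relation.Nullary.Decidable using (Dec; yes; no; does; dec-true; dec-false; does-⇔)
import Relation.Nullary.Decidable as Dec
open import Relation.Nullary.Negation using (¬_)
open import Relation.Binary.PropositionalEquality using (_≡_; _≢_; refl; sym; trans; cong; cong₂; subst; module ≡-Reasoning)

variable
  A B : Set
  m n o p q : ℕ

-- Prefixes of sequences

Prefix : (ℕ → A) → List A → Set
Prefix x w = applyUpTo x (length w) ≡ w

length-∷ʳ : ∀ (w : List A) {y} → length (w ∷ʳ y) ≡ suc (length w)
length-∷ʳ w = trans (length-++ w) (+-comm (length w) 1)

prefix-∷ʳ : ∀ {x : ℕ → A} w {y} → Prefix x w → x (length w) ≡ y → Prefix x (w ∷ʳ y)
prefix-∷ʳ {x = x} w {y} pre x≡y = begin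
  applyUpTo x (length (w ∷ʳ y))           ≡⟨ cong (applyUpTo x) (length-∷ʳ w) ⟩
  applyUpTo x (suc (length w))            ≡⟨ applyUpTo-∷ʳ x (length w) ⟨
  applyUpTo x (length w) ∷ʳ x (length w)  ≡⟨ cong₂ _∷ʳ_ pre x≡y ⟩
  w ∷ʳ y                                  ∎
  where open ≡-Reasoning

prefix⇒lookup : ∀ {x : ℕ → A} w {i} → Prefix x w → (i<∣w∣ : i < length w) → x i ≡ lookup w (fromℕ< i<∣w∣)
prefix⇒lookup (y ∷ w) {zero} pre _ = ∷-injectiveˡ pre
prefix⇒lookup {x = x} (y ∷ w) {suc i} pre (s≤s i<∣w∣) = prefix⇒lookup {x = x ∘ suc} w (∷-injectiveʳ pre) i<∣w∣

lookup⇒prefix : ∀ {x : ℕ → A} w → (∀ i (i<∣w∣ : i < length w) → x i ≡ lookup w (fromℕ< i<∣w∣)) → Prefix x w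
lookup⇒prefix [] _ = refl
lookup⇒prefix {x = x} (y ∷ w) agree =
  cong₂ _∷_ (agree 0 z<s) (lookup⇒prefix {x = x ∘ suc} w (λ i i<∣w∣ → agree (suc i) (s≤s i<∣w∣)))

prefix-map : ∀ (h : A → B) {x} w → Prefix x w → Prefix (h ∘ x) (map h w)
prefix-map h {x} w pre = begin
  applyUpTo (h ∘ x) (length (map h w))  ≡⟨ cong (applyUpTo (h ∘ x)) (length-map h w) ⟩
  applyUpTo (h ∘ x) (length w)          ≡⟨ map-applyUpTo x h (length w) ⟨
  map h (applyUpTo x (length w))        ≡⟨ cong (map h) pre ⟩
  map h w                               ∎
  where open ≡-Reasoning

prefixes-agree : ∀ {x y : ℕ → A} w {i} → Prefix x w → Prefix y w → i < length w → x i ≡ y i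
prefixes-agree w x-pre y-pre i<∣w∣ = trans (prefix⇒lookup w x-pre i<∣w∣) (sym (prefix⇒lookup w y-pre i<∣w∣))

prefixes⇒limit : ∀ {x : ℕ → A} {w : ℕ → List A} →
  (∀ n → Prefix x (w n)) → (∀ N → ∃[ n ] N < length (w n)) → IsLimitOf x w
prefixes⇒limit pre unbounded = (λ n i i<∣w∣ → prefix⇒lookup _ (pre n) i<∣w∣) , unbounded

lookup-++ˡ : ∀ (u : List A) {v i} (i<∣u∣ : i < length u) .(i<∣u++v∣ : i < length (u ++ v)) →
  lookup (u ++ v) (fromℕ< i<∣u++v∣) ≡ lookup u (fromℕ< i<∣u∣)
lookup-++ˡ (y ∷ u) {i = zero} _ _ = refl
lookup-++ˡ (y ∷ u) {i = suc i} (s≤s i<∣u∣) i<∣u++v∣ = lookup-++ˡ u i<∣u∣ (s≤s⁻¹ i<∣u++v∣)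

lookup-extension : ∀ (u : List A) {v w i} → v ≡ u ++ w → (i<∣u∣ : i < length u) .(i<∣v∣ : i < length v) →
  lookup v (fromℕ< i<∣v∣) ≡ lookup u (fromℕ< i<∣u∣)
lookup-extension u refl = lookup-++ˡ u

-- Iterates of morphisms

concatMap-∷ʳ : ∀ (φ : A → List B) w y → concatMap φ (w ∷ʳ y) ≡ concatMap φ w ++ φ y
concatMap-∷ʳ φ w y = trans (concatMap-++ φ w [ y ]) (cong (concatMap φ w ++_) (++-identityʳ (φ y)))

length≤length-concatMap : ∀ {φ : A → List B} → (∀ y → 0 < length (φ y)) → ∀ w → length w ≤ length (concatMap φ w)
length≤length-concatMap φ-nonempty [] = z≤n
length≤length-concatMap {φ = φ} φ-nonempty (y ∷ w) = begin
  suc (length w)                              ≤⟨ +-mono-≤ (φ-nonempty y) (length≤length-concatMap φ-nonempty w) ⟩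
  length (φ y) + length (concatMap φ w)       ≡⟨ length-++ (φ y) ⟨
  length (φ y ++ concatMap φ w)               ∎
  where open ≤-Reasoning

module _ {φ : A → List A} {x : ℕ → A} (φ-x : ∀ s → φ (x s) ≡ x (2 * s) ∷ x (1 + 2 * s) ∷ []) where

  concatMap-applyUpTo-double : ∀ L → concatMap φ (applyUpTo x L) ≡ applyUpTo x (2 * L)
  concatMap-applyUpTo-double zero = refl
  concatMap-applyUpTo-double (suc L) = begin
    concatMap φ (applyUpTo x (suc L))                        ≡⟨ cong (concatMap φ) (applyUpTo-∷ʳ x L) ⟨
    concatMap φ (applyUpTo x L ∷ʳ x L)                       ≡⟨ concatMap-∷ʳ φ (applyUpTo x L) (x L) ⟩
    concatMap φ (applyUpTo x L) ++ φ (x L)                   ≡⟨ cong₂ _++_ (concatMap-applyUpTo-double L) (φ-x L) ⟩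
    applyUpTo x (2 * L) ++ x (2 * L) ∷ x (1 + 2 * L) ∷ []    ≡⟨ ++-assoc (applyUpTo x (2 * L)) [ x (2 * L) ] [ x (1 + 2 * L) ] ⟨
    applyUpTo x (2 * L) ∷ʳ x (2 * L) ∷ʳ x (1 + 2 * L)        ≡⟨ cong (_∷ʳ x (1 + 2 * L)) (applyUpTo-∷ʳ x (2 * L)) ⟩
    applyUpTo x (1 + 2 * L) ∷ʳ x (1 + 2 * L)                 ≡⟨ applyUpTo-∷ʳ x (1 + 2 * L) ⟩
    applyUpTo x (2 + 2 * L)                                  ≡⟨ cong (applyUpTo x) (*-suc 2 L) ⟨
    applyUpTo x (2 * suc L)                                  ∎
    where open ≡-Reasoning

  iter-2-uniform : ∀ n → iter φ n [ x 0 ] ≡ applyUpTo x (2 ^ n)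
  iter-2-uniform zero = refl
  iter-2-uniform (suc n) = trans (cong (ext φ) (iter-2-uniform n)) (concatMap-applyUpTo-double (2 ^ n))

module _ {φ : A → List A} {b : A} {rest : List A} (φb≡b∷rest : φ b ≡ b ∷ rest) where

  iter-suc-extends : ∀ n → ∃[ u ] iter φ (suc n) [ b ] ≡ iter φ n [ b ] ++ u
  iter-suc-extends zero = rest ++ [] , cong (_++ []) φb≡b∷rest
  iter-suc-extends (suc n) with u , eq ← iter-suc-extends n =
    concatMap φ u , trans (cong (concatMap φ) eq) (concatMap-++ φ (iter φ n [ b ]) u)

  iter-extends : ∀ n → m ≤ n → ∃[ u ] iter φ n [ b ] ≡ iter φ m [ b ] ++ u
  iter-extends zero z≤n = [] , sym (++-identityʳ _)
  iter-extends (suc n) m≤1+n with m≤n⇒m<n∨m≡n m≤1+n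
  ... | inj₂ refl = [] , sym (++-identityʳ _)
  ... | inj₁ m<1+n with u , eq ← iter-extends n (s≤s⁻¹ m<1+n) | u′ , eq′ ← iter-suc-extends n =
    u ++ u′ , trans eq′ (trans (cong (_++ u′) eq) (++-assoc _ u u′))

  lookup-iter : ∀ m n {i} (i<m : i < length (iter φ m [ b ])) (i<n : i < length (iter φ n [ b ])) →
    lookup (iter φ m [ b ]) (fromℕ< i<m) ≡ lookup (iter φ n [ b ]) (fromℕ< i<n)
  lookup-iter m n i<m i<n with ≤-total m n
  ... | inj₁ m≤n = sym (lookup-extension (iter φ m [ b ]) (proj₂ (iter-extends n m≤n)) i<m i<n)
  ... | inj₂ n≤m = lookup-extension (iter φ n [ b ]) (proj₂ (iter-extends m n≤m)) i<n i<m

  prolongable-limit : (∀ N → ∃[ n ] N < length (iter φ n [ b ])) →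
    Σ (ℕ → A) λ x → ∀ n → Prefix x (iter φ n [ b ])
  prolongable-limit unbounded = x , λ n → lookup⇒prefix _ (λ i → lookup-iter (proj₁ (unbounded i)) n (proj₂ (unbounded i)))
    where
    x : ℕ → A
    x i = lookup (iter φ (proj₁ (unbounded i)) [ b ]) (fromℕ< (proj₂ (unbounded i)))

-- Odd parts and good numbers

odd≢even : ∀ m → n % 2 ≡ 1 → n ≢ 2 * m
odd≢even m n%2≡1 refl = 0≢1+n (trans (sym [2m]%2≡0) n%2≡1)
  where
  [2m]%2≡0 : (2 * m) % 2 ≡ 0
  [2m]%2≡0 = trans (cong (_% 2) (*-comm 2 m)) (m*n%n≡0 m 2)

isOddPart-self : n % 2 ≡ 1 → IsOddPart n n
isOddPart-self {n} n%2≡1 = 0 , sym (*-identityˡ n) , n%2≡1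

isOddPart-odd : n % 2 ≡ 1 → IsOddPart n o → o ≡ n
isOddPart-odd _ (zero , n≡o , _) = sym (trans n≡o (*-identityˡ _))
isOddPart-odd {o = o} n%2≡1 (suc v , n≡ , _) = ⊥-elim (odd≢even (2 ^ v * o) n%2≡1 (trans n≡ (*-assoc 2 (2 ^ v) o)))

isOddPart-double : IsOddPart m o → IsOddPart (2 * m) o
isOddPart-double {o = o} (v , m≡ , o%2≡1) = suc v , trans (cong (2 *_) m≡) (sym (*-assoc 2 (2 ^ v) o)) , o%2≡1

isOddPart-half : IsOddPart (2 * m) o → IsOddPart m o
isOddPart-half {m} (zero , 2m≡o , o%2≡1) = ⊥-elim (odd≢even m o%2≡1 (sym (trans 2m≡o (*-identityˡ _))))
isOddPart-half {m} {o} (suc v , 2m≡ , o%2≡1) =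
  v , *-cancelˡ-≡ m (2 ^ v * o) 2 (trans 2m≡ (*-assoc 2 (2 ^ v) o)) , o%2≡1

¬good-0 : ¬ Good 0
¬good-0 (() , _)

good-double : Good (2 * m) ⇔ Good m
good-double = mk⇔
  (λ (0<2m , o , op , 4k+1) → positive-half 0<2m , o , isOddPart-half op , 4k+1)
  (λ (0<m , o , op , 4k+1) → <-≤-trans 0<m (m≤m+n _ _) , o , isOddPart-double op , 4k+1)
  where
  positive-half : 0 < 2 * m → 0 < m
  positive-half {suc m} _ = z<s

2∣4k : ∀ k → 2 ∣ 4 * k
2∣4k k = ∣-trans (divides 2 refl) (m∣m*n k)

good-1+4k : ∀ k → Good (1 + 4 * k)
good-1+4k k = z<s , 1 + 4 * k , isOddPart-self (%-remove-+ʳ 1 (2∣4k k)) , k , +-comm 1 (4 * k)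

¬good-3+4k : ∀ k → ¬ Good (3 + 4 * k)
¬good-3+4k k (_ , o , op , j , o≡4j+1) = 0≢1+n (suc-injective 1≡3)
  where
  1≡3 : 1 ≡ 3
  1≡3 = begin
    1                  ≡⟨ %-remove-+ˡ 1 (m∣m*n j) ⟨
    (4 * j + 1) % 4    ≡⟨ cong (_% 4) (trans (sym o≡4j+1) (isOddPart-odd (%-remove-+ʳ 3 (2∣4k k)) op)) ⟩
    (3 + 4 * k) % 4    ≡⟨ %-remove-+ʳ 3 (m∣m*n {4} k) ⟩
    3                  ∎
    where open ≡-Reasoning

data EvenOrOdd : ℕ → Set where
  even : ∀ k → EvenOrOdd (2 * k)
  odd  : ∀ k → EvenOrOdd (1 + 2 * k)

evenOrOdd : ∀ n → EvenOrOdd n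
evenOrOdd zero = even 0
evenOrOdd (suc n) with evenOrOdd n
... | even k = odd k
... | odd k = subst EvenOrOdd (*-suc 2 k) (even (suc k))

good? : ∀ n → Dec (Good n)
good? = <-rec (Dec ∘ Good) decide
  where
  4j+1 : ∀ j → 1 + 4 * j ≡ 1 + 2 * (2 * j)
  4j+1 = solve-∀
  4j+3 : ∀ j → 3 + 4 * j ≡ 1 + 2 * (1 + 2 * j)
  4j+3 = solve-∀
  decide : ∀ n → (∀ {m} → m < n → Dec (Good m)) → Dec (Good n)
  decide n rec with evenOrOdd n
  ... | even zero = no ¬good-0
  ... | even m@(suc _) = Dec.map (⇔-sym good-double) (rec (m<m+n m z<s))
  ... | odd k with evenOrOdd k
  ...   | even j = yes (subst Good (4j+1 j) (good-1+4k j))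
  ...   | odd j = no (subst (¬_ ∘ Good) (4j+3 j) (¬good-3+4k j))

IsNextGood : ℕ → ℕ → Set
IsNextGood p q = p < q × Good q × (∀ r → p < r → r < q → ¬ Good r)

isNextGood-after : ∀ k → Good (suc k + p) → (∀ t → t < k → ¬ Good (suc t + p)) → IsNextGood p (suc k + p)
isNextGood-after {p} k good skipped = s≤s (m≤n+m p k) , good , between
  where
  between : ∀ r → p < r → r < suc k + p → ¬ Good r
  between r p<r r<q with t , refl ← m≤n⇒∃[o]m+o≡n p<r =
    subst (¬_ ∘ Good) (cong suc (+-comm t p))
      (skipped t (+-cancelˡ-< p t k (subst (p + t <_) (+-comm k p) (s≤s⁻¹ r<q))))

GoodGaps : ℕ → List ℕ → Set
GoodGaps p []       = ⊤
GoodGaps p (d ∷ ds) = IsNextGood p (d + p) × GoodGaps (d + p) ds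

-- Blocks of four consecutive numbers

isGood : ℕ → Bool
isGood n = does (good? n)

isGood-double : ∀ m → n ≡ 2 * m → isGood n ≡ isGood m
isGood-double m refl = does-⇔ good-double (good? (2 * m)) (good? m)

isGood-1+4k : ∀ k → isGood (1 + 4 * k) ≡ true
isGood-1+4k k = dec-true (good? _) (good-1+4k k)

isGood-3+4k : ∀ k → isGood (3 + 4 * k) ≡ false
isGood-3+4k k = dec-false (good? _) (¬good-3+4k k)

letter : Bool → Bool → L4
letter true  true  = l0
letter false true  = l1
letter true  false = l2
letter false false = l3

f-letter : ∀ b c → f (letter b c) ≡ letter true b ∷ letter false c ∷ []
f-letter true  true  = refl
f-letter false true  = refl
f-letter true  false = refl
f-letter false false = refl

blockLetter : ℕ → L4
blockLetter s = letter (isGood (2 + 4 * s)) (isGood (4 + 4 * s))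

blockLetter-0 : blockLetter 0 ≡ l0
blockLetter-0 = cong₂ letter
  (trans (isGood-double 1 refl) (isGood-1+4k 0))
  (trans (isGood-double 2 refl) (trans (isGood-double 1 refl) (isGood-1+4k 0)))

f-blockLetter : ∀ s → f (blockLetter s) ≡ blockLetter (2 * s) ∷ blockLetter (1 + 2 * s) ∷ []
f-blockLetter s = trans (f-letter _ _) (cong₂ (λ x y → x ∷ y ∷ [])
  (cong₂ letter (sym (trans (isGood-double (1 + 4 * s) (8s+2 s)) (isGood-1+4k s))) (sym (isGood-double (2 + 4 * s) (8s+4 s))))
  (cong₂ letter (sym (trans (isGood-double (3 + 4 * s) (8s+6 s)) (isGood-3+4k s))) (sym (isGood-double (4 + 4 * s) (8s+8 s)))))
  where
  8s+2 : ∀ s → 2 + 4 * (2 * s) ≡ 2 * (1 + 4 * s)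
  8s+2 = solve-∀
  8s+4 : ∀ s → 4 + 4 * (2 * s) ≡ 2 * (2 + 4 * s)
  8s+4 = solve-∀
  8s+6 : ∀ s → 2 + 4 * (1 + 2 * s) ≡ 2 * (3 + 4 * s)
  8s+6 = solve-∀
  8s+8 : ∀ s → 4 + 4 * (1 + 2 * s) ≡ 2 * (4 + 4 * s)
  8s+8 = solve-∀

iter-f-blockLetter : ∀ n → iter f n [ l0 ] ≡ applyUpTo blockLetter (2 ^ n)
iter-f-blockLetter n = subst (λ l → iter f n [ l ] ≡ applyUpTo blockLetter (2 ^ n)) blockLetter-0 (iter-2-uniform f-blockLetter n)

goodGaps-block : ∀ s → GoodGaps (1 + 4 * s) (g (blockLetter s))
goodGaps-block s = gaps (good? (2 + 4 * s)) (good? (4 + 4 * s))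
  where
  4s+3-bad : ¬ Good (3 + 4 * s)
  4s+3-bad = ¬good-3+4k s
  4s+5-good : Good (5 + 4 * s)
  4s+5-good = subst Good (cong (1 +_) (*-suc 4 s)) (good-1+4k (suc s))
  gaps : (d₂ : Dec (Good (2 + 4 * s))) (d₄ : Dec (Good (4 + 4 * s))) →
    GoodGaps (1 + 4 * s) (g (letter (does d₂) (does d₄)))
  gaps (yes good₂) (yes good₄) =
    isNextGood-after 0 good₂ (λ _ ()) ,
    isNextGood-after 1 good₄ (λ { zero _ → 4s+3-bad ; (suc _) (s≤s ()) }) ,
    isNextGood-after 0 4s+5-good (λ _ ()) , tt
  gaps (no bad₂) (yes good₄) =
    isNextGood-after 2 good₄ (λ { 0 _ → bad₂ ; 1 _ → 4s+3-bad ; (suc (suc _)) (s≤s (s≤s ())) }) ,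
    isNextGood-after 0 4s+5-good (λ _ ()) , tt
  gaps (yes good₂) (no bad₄) =
    isNextGood-after 0 good₂ (λ _ ()) ,
    isNextGood-after 2 4s+5-good (λ { 0 _ → 4s+3-bad ; 1 _ → bad₄ ; (suc (suc _)) (s≤s (s≤s ())) }) , tt
  gaps (no bad₂) (no bad₄) =
    isNextGood-after 3 4s+5-good (λ { 0 _ → bad₂ ; 1 _ → 4s+3-bad ; 2 _ → bad₄ ; (suc (suc (suc _))) (s≤s (s≤s (s≤s ()))) }) , tt

sum-g : ∀ l → sum (g l) ≡ 4
sum-g l0 = refl
sum-g l1 = refl
sum-g l2 = refl
sum-g l3 = refl

g-nonempty : ∀ l → 0 < length (g l)
g-nonempty l0 = z<s
g-nonempty l1 = z<s
g-nonempty l2 = z<s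
g-nonempty l3 = z<s

n<2^n : ∀ n → n < 2 ^ n
n<2^n zero = z<s
n<2^n (suc n) = ≤-<-trans (n<2^n n) (^-monoʳ-< 2 (s≤s z<s) (n<1+n n))

g-unbounded : ∀ n → n < length (ext g (iter f n [ l0 ]))
g-unbounded n = begin-strict
  n                                        <⟨ n<2^n n ⟩
  2 ^ n                                    ≡⟨ length-applyUpTo blockLetter (2 ^ n) ⟨
  length (applyUpTo blockLetter (2 ^ n))   ≡⟨ cong length (iter-f-blockLetter n) ⟨
  length (iter f n [ l0 ])                 ≤⟨ length≤length-concatMap g-nonempty (iter f n [ l0 ]) ⟩
  length (ext g (iter f n [ l0 ]))         ∎
  where open ≤-Reasoning

-- A morphism on eight letters absorbing g

pattern start = Fin.zero
pattern head₀ = Fin.suc Fin.zero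
pattern head₁ = Fin.suc (Fin.suc Fin.zero)
pattern head₂ = Fin.suc (Fin.suc (Fin.suc Fin.zero))
pattern head₃ = Fin.suc (Fin.suc (Fin.suc (Fin.suc Fin.zero)))
pattern tail₁ = Fin.suc (Fin.suc (Fin.suc (Fin.suc (Fin.suc Fin.zero))))
pattern tail₂ = Fin.suc (Fin.suc (Fin.suc (Fin.suc (Fin.suc (Fin.suc Fin.zero)))))
pattern tail₃ = Fin.suc (Fin.suc (Fin.suc (Fin.suc (Fin.suc (Fin.suc (Fin.suc Fin.zero))))))

G : L4 → List (Fin 8)
G l0 = head₀ ∷ tail₂ ∷ tail₁ ∷ []
G l1 = head₁ ∷ tail₁ ∷ []
G l2 = head₂ ∷ tail₃ ∷ []
G l3 = head₃ ∷ []

-- The leading block g(0) is written with erasable letters, and σ(start) supplies G(1), the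
-- rest of G(f(0)); everywhere else σ(G(w)) = G(f(w)).
σ : Fin 8 → List (Fin 8)
σ start = start ∷ tail₁ ∷ tail₂ ∷ tail₁ ∷ G l1
σ head₀ = ext G (f l0)
σ head₁ = ext G (f l1)
σ head₂ = ext G (f l2)
σ head₃ = ext G (f l3)
σ tail₁ = []
σ tail₂ = []
σ tail₃ = []

τ : Fin 8 → ℕ
τ start = 1
τ head₀ = 1
τ head₁ = 3
τ head₂ = 1
τ head₃ = 4
τ tail₁ = 1
τ tail₂ = 2
τ tail₃ = 3

σ-G : ∀ w → ext σ (ext G w) ≡ ext G (ext f w)
σ-G [] = refl
σ-G (l ∷ w) = begin
  ext σ (G l ++ ext G w)              ≡⟨ concatMap-++ σ (G l) (ext G w) ⟩
  ext σ (G l) ++ ext σ (ext G w)      ≡⟨ cong₂ _++_ (σ-G-letter l) (σ-G w) ⟩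
  ext G (f l) ++ ext G (ext f w)      ≡⟨ concatMap-++ G (f l) (ext f w) ⟨
  ext G (f l ++ ext f w)              ∎
  where
  open ≡-Reasoning
  σ-G-letter : ∀ l → ext σ (G l) ≡ ext G (f l)
  σ-G-letter l0 = refl
  σ-G-letter l1 = refl
  σ-G-letter l2 = refl
  σ-G-letter l3 = refl

τ-G : ∀ w → map τ (ext G w) ≡ ext g w
τ-G w = trans (map-concatMap τ G w) (concatMap-cong τ-G-letter w)
  where
  τ-G-letter : ∀ l → map τ (G l) ≡ g l
  τ-G-letter l0 = refl
  τ-G-letter l1 = refl
  τ-G-letter l2 = refl
  τ-G-letter l3 = refl

tails : ℕ → List L4
tails zero = []
tails (suc n) = l1 ∷ ext f (tails n)

iter-f-l0 : ∀ n → iter f n [ l0 ] ≡ l0 ∷ tails n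
iter-f-l0 zero = refl
iter-f-l0 (suc n) = cong (ext f) (iter-f-l0 n)

iter-σ-start : ∀ n → iter σ (suc n) [ start ] ≡ start ∷ tail₁ ∷ tail₂ ∷ tail₁ ∷ ext G (tails (suc n))
iter-σ-start zero = refl
iter-σ-start (suc n) =
  trans (cong (ext σ) (iter-σ-start n)) (cong (λ w → start ∷ tail₁ ∷ tail₂ ∷ tail₁ ∷ G l1 ++ w) (σ-G (tails (suc n))))

τ-iter-σ : ∀ n → map τ (iter σ (suc n) [ start ]) ≡ 1 ∷ ext g (iter f (suc n) [ l0 ])
τ-iter-σ n = begin
  map τ (iter σ (suc n) [ start ])                  ≡⟨ cong (map τ) (iter-σ-start n) ⟩
  1 ∷ 1 ∷ 2 ∷ 1 ∷ map τ (ext G (tails (suc n)))     ≡⟨ cong (λ w → 1 ∷ 1 ∷ 2 ∷ 1 ∷ w) (τ-G (tails (suc n))) ⟩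
  1 ∷ ext g (l0 ∷ tails (suc n))                    ≡⟨ cong (λ w → 1 ∷ ext g w) (iter-f-l0 (suc n)) ⟨
  1 ∷ ext g (iter f (suc n) [ l0 ])                 ∎
  where open ≡-Reasoning

σ-grows : ∀ n → n < length (iter σ (suc n) [ start ])
σ-grows n = begin-strict
  n                                           <⟨ n<1+n n ⟩
  suc n                                       <⟨ g-unbounded (suc n) ⟩
  length (ext g (iter f (suc n) [ l0 ]))      <⟨ n<1+n _ ⟩
  length (1 ∷ ext g (iter f (suc n) [ l0 ]))  ≡⟨ cong length (τ-iter-σ n) ⟨
  length (map τ (iter σ (suc n) [ start ]))   ≡⟨ length-map τ (iter σ (suc n) [ start ]) ⟩
  length (iter σ (suc n) [ start ])           ∎
  where open ≤-Reasoning hiding (start)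

σ-unbounded : ∀ N → ∃[ n ] N < length (iter σ n [ start ])
σ-unbounded N = suc N , σ-grows N

σ-fixedPoint : ℕ → Fin 8
σ-fixedPoint = proj₁ (prolongable-limit refl σ-unbounded)

σ-fixedPoint-prefix : ∀ n → Prefix σ-fixedPoint (iter σ n [ start ])
σ-fixedPoint-prefix = proj₂ (prolongable-limit refl σ-unbounded)

-- The enumeration of the good numbers

module Enumeration {a : ℕ → ℕ} (a-enum : IsGoodSeq a) where

  private
    a₀≡0 : a 0 ≡ 0
    a₀≡0 = proj₁ a-enum

    a-< : ∀ n → a n < a (suc n)
    a-< = proj₁ (proj₂ a-enum)

    enumerates : ∀ m → Good m ⇔ (∃[ n ] a (suc n) ≡ m)
    enumerates = proj₂ (proj₂ a-enum)

  a-good : ∀ n → Good (a (suc n))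
  a-good n = Equivalence.from (enumerates _) (n , refl)

  a-strictMono : m < n → a m < a n
  a-strictMono {n = suc n} m<1+n with m≤n⇒m<n∨m≡n (s≤s⁻¹ m<1+n)
  ... | inj₁ m<n = <-trans (a-strictMono m<n) (a-< n)
  ... | inj₂ refl = a-< n

  a-cancel-< : a m < a n → m < n
  a-cancel-< {m} {n} am<an with <-cmp m n
  ... | tri< m<n _ _ = m<n
  ... | tri≈ _ refl _ = ⊥-elim (<-irrefl refl am<an)
  ... | tri> _ _ n<m = ⊥-elim (<-asym am<an (a-strictMono n<m))

  a-next : a n ≡ p → IsNextGood p q → a (suc n) ≡ q
  a-next {n} {q = q} refl (aₙ<q , good-q , between) with <-cmp (a (suc n)) q
  ... | tri< a₁₊ₙ<q _ _ = ⊥-elim (between _ (a-< n) a₁₊ₙ<q (a-good n))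
  ... | tri≈ _ a₁₊ₙ≡q _ = a₁₊ₙ≡q
  ... | tri> _ _ q<a₁₊ₙ with m , refl ← Equivalence.to (enumerates _) good-q =
    ⊥-elim (<⇒≱ (a-cancel-< q<a₁₊ₙ) (a-cancel-< aₙ<q))

  prefix-goodGaps : ∀ w ds → Prefix (diffs a) w → a (length w) ≡ p → GoodGaps p ds →
    Prefix (diffs a) (w ++ ds) × a (length (w ++ ds)) ≡ sum ds + p
  prefix-goodGaps {p} w [] pre aw≡p _ = subst (λ v → Prefix (diffs a) v × a (length v) ≡ p) (sym (++-identityʳ w)) (pre , aw≡p)
  prefix-goodGaps {p} w (d ∷ ds) pre aw≡p (next , gaps) =
    subst (λ v → Prefix (diffs a) v × a (length v) ≡ sum (d ∷ ds) + p) (++-assoc w [ d ] ds)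
      (map₂ (λ a≡ → trans a≡ (+-comm-middle (sum ds) d p))
        (prefix-goodGaps (w ∷ʳ d) ds (prefix-∷ʳ w pre diff≡d) (trans (cong a (length-∷ʳ w)) a₁₊ₙ≡d+p) gaps))
    where
    a₁₊ₙ≡d+p : a (suc (length w)) ≡ d + p
    a₁₊ₙ≡d+p = a-next aw≡p next
    diff≡d : diffs a (length w) ≡ d
    diff≡d = trans (cong₂ _∸_ a₁₊ₙ≡d+p aw≡p) (m+n∸n≡m d p)
    +-comm-middle : ∀ x y z → x + (y + z) ≡ y + x + z
    +-comm-middle = solve-∀

  prefix-blocks : ∀ L → let w = 1 ∷ ext g (applyUpTo blockLetter L) in
    Prefix (diffs a) w × a (length w) ≡ 1 + 4 * L
  prefix-blocks zero = prefix-goodGaps [] [ 1 ] refl a₀≡0 (isNextGood-after 0 (good-1+4k 0) (λ _ ()) , tt)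
  prefix-blocks (suc L) with pre , a≡ ← prefix-blocks L =
    subst (λ w → Prefix (diffs a) w × a (length w) ≡ 1 + 4 * suc L) (sym words-suc)
      (map₂ (λ a≡′ → trans a≡′ sum-step) (prefix-goodGaps _ (g (blockLetter L)) pre a≡ (goodGaps-block L)))
    where
    words-suc : 1 ∷ ext g (applyUpTo blockLetter (suc L)) ≡ (1 ∷ ext g (applyUpTo blockLetter L)) ++ g (blockLetter L)
    words-suc = cong (1 ∷_) (trans (cong (ext g) (sym (applyUpTo-∷ʳ blockLetter L))) (concatMap-∷ʳ g (applyUpTo blockLetter L) (blockLetter L)))
    sum-step : sum (g (blockLetter L)) + (1 + 4 * L) ≡ 1 + 4 * suc L
    sum-step = trans (cong (_+ (1 + 4 * L)) (sum-g (blockLetter L))) (cong (1 +_) (sym (*-suc 4 L)))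

  prefix-diffs : ∀ n → Prefix (diffs a) (1 ∷ ext g (iter f n [ l0 ]))
  prefix-diffs n = subst (λ w → Prefix (diffs a) (1 ∷ ext g w)) (sym (iter-f-blockLetter n)) (proj₁ (prefix-blocks (2 ^ n)))

  diffs≡τ∘σ-fixedPoint : ∀ i → diffs a i ≡ τ (σ-fixedPoint i)
  diffs≡τ∘σ-fixedPoint i = prefixes-agree (map τ (iter σ (suc i) [ start ]))
    (subst (Prefix (diffs a)) (sym (τ-iter-σ i)) (prefix-diffs (suc i)))
    (prefix-map τ _ (σ-fixedPoint-prefix (suc i)))
    (subst (i <_) (sym (length-map τ (iter σ (suc i) [ start ]))) (σ-grows i))

theorem11 : (a : ℕ → ℕ) → IsGoodSeq a →
    IsLimitOf (λ n → diffs a (suc n)) (λ n → ext g (iter f n [ l0 ])) ×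
    IsMorphic (diffs a)
theorem11 a a-enum =
  prefixes⇒limit (λ n → ∷-injectiveʳ (prefix-diffs n)) (λ N → N , g-unbounded N) ,
  (8 , σ , start , _ , refl , σ-fixedPoint , τ , prefixes⇒limit σ-fixedPoint-prefix σ-unbounded , diffs≡τ∘σ-fixedPoint)
  where open Enumeration a-enum
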